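{- The system $\mathbf{HK}\Box$ is a conservative extension of $\mathbf{MI_{\Box}}$: for every formula $\phi$ built from proposition letters, $\top$, $\wedge$, $\to$ and $\Box$, we have $\mathbf{HK}\Box\vdash\phi$ if and only if $\mathbf{MI_{\Box}}\vdash\phi$.
   Context: $\mathbf{MI_{\Box}}$ is derived by modus ponens from substitution instances of $p\to(q\to p)$, $(p\to(q\to r))\to((p\to q)\to(p\to r))$, $(p\wedge q)\to p$, $(p\wedge q)\to q$, $p\to(q\to(p\wedge q))$, $\top$, $\Box(p\wedge q)\leftrightarrow(\Box p\wedge\Box q)$, $\Box\top\leftrightarrow\top$, closed under the rule from $p\leftrightarrow q$ infer $\Box p\leftrightarrow\Box q$. $\mathbf{HK}\Box$ is the modal intuitionistic logic of Božić and Došen in the language of intuitionistic propositional logic extended with $\Box$, axiomatised over intuitionistic logic by $\Box(p\wedge q)\leftrightarrow(\Box p\wedge\Box q)$ and $\Box\top\leftrightarrow\top$; it is sound and complete with respect to $H\Box$-frames: tuples $(X,\leq,R)$ with $\leq$ a preorder and $R$ a relation satisfying $({\leq}\circ R)\subseteq(R\circ{\leq})$ (where $x(R_1\circ R_2)z$ iff $\exists y$, $xR_1y$, $yR_2z$), with valuations assigning up-closed sets, intuitionistic connectives interpreted as in Kripke semantics, and $x\Vdash\Box\phi$ iff every $y$ with $xRy$ satisfies $\phi$. -}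

module Defs where

open import Data.Nat using (ℕ)

infixr 6 _∧_
infixr 5 _∨_
infixr 4 _⇒_
infixr 4 _⟺_

data Fm : Set where
  var : ℕ → Fm
  ⊤′  : Fm
  ⊥′  : Fm
  _∧_ : Fm → Fm → Fm
  _∨_ : Fm → Fm → Fm
  _⇒_ : Fm → Fm → Fm
  □   : Fm → Fm

_⟺_ : Fm → Fm → Fm
p ⟺ q = (p ⇒ q) ∧ (q ⇒ p)

data HK⊢_ : Fm → Set where
  ax-K   : ∀ p q → HK⊢ (p ⇒ (q ⇒ p))
  ax-S   : ∀ p q r → HK⊢ ((p ⇒ (q ⇒ r)) ⇒ ((p ⇒ q) ⇒ (p ⇒ r)))
  ax-∧e₁ : ∀ p q → HK⊢ ((p ∧ q) ⇒ p)
  ax-∧e₂ : ∀ p q → HK⊢ ((p ∧ q) ⇒ q)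
  ax-∧i  : ∀ p q → HK⊢ (p ⇒ (q ⇒ (p ∧ q)))
  ax-∨i₁ : ∀ p q → HK⊢ (p ⇒ (p ∨ q))
  ax-∨i₂ : ∀ p q → HK⊢ (q ⇒ (p ∨ q))
  ax-∨e  : ∀ p q r → HK⊢ ((p ⇒ r) ⇒ ((q ⇒ r) ⇒ ((p ∨ q) ⇒ r)))
  ax-⊥   : ∀ p → HK⊢ (⊥′ ⇒ p)
  ax-⊤   : HK⊢ ⊤′
  ax-□∧  : ∀ p q → HK⊢ (□ (p ∧ q) ⟺ (□ p ∧ □ q))
  ax-□⊤  : HK⊢ (□ ⊤′ ⟺ ⊤′)
  mp     : ∀ {p q} → HK⊢ (p ⇒ q) → HK⊢ p → HK⊢ q
  cong□  : ∀ {p q} → HK⊢ (p ⟺ q) → HK⊢ (□ p ⟺ □ q)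

infixr 6 _∧₀_
infixr 4 _⇒₀_
infixr 4 _⟺₀_

data Fm₀ : Set where
  var₀ : ℕ → Fm₀
  ⊤₀   : Fm₀
  _∧₀_ : Fm₀ → Fm₀ → Fm₀
  _⇒₀_ : Fm₀ → Fm₀ → Fm₀
  □₀   : Fm₀ → Fm₀

_⟺₀_ : Fm₀ → Fm₀ → Fm₀
p ⟺₀ q = (p ⇒₀ q) ∧₀ (q ⇒₀ p)

data MI⊢_ : Fm₀ → Set where
  ax-K   : ∀ p q → MI⊢ (p ⇒₀ (q ⇒₀ p))
  ax-S   : ∀ p q r → MI⊢ ((p ⇒₀ (q ⇒₀ r)) ⇒₀ ((p ⇒₀ q) ⇒₀ (p ⇒₀ r)))
  ax-∧e₁ : ∀ p q → MI⊢ ((p ∧₀ q) ⇒₀ p)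
  ax-∧e₂ : ∀ p q → MI⊢ ((p ∧₀ q) ⇒₀ q)
  ax-∧i  : ∀ p q → MI⊢ (p ⇒₀ (q ⇒₀ (p ∧₀ q)))
  ax-⊤   : MI⊢ ⊤₀
  ax-□∧  : ∀ p q → MI⊢ (□₀ (p ∧₀ q) ⟺₀ (□₀ p ∧₀ □₀ q))
  ax-□⊤  : MI⊢ (□₀ ⊤₀ ⟺₀ ⊤₀)
  mp     : ∀ {p q} → MI⊢ (p ⇒₀ q) → MI⊢ p → MI⊢ q
  cong□  : ∀ {p q} → MI⊢ (p ⟺₀ q) → MI⊢ (□₀ p ⟺₀ □₀ q)

embed : Fm₀ → Fm
embed (var₀ n) = var n
embed ⊤₀       = ⊤′
embed (p ∧₀ q) = embed p ∧ embed q
embed (p ⇒₀ q) = embed p ⇒ embed q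
embed (□₀ p)   = □ (embed p)

-- Interpret HK□ formulas as down-sets of the preorder of MI□ formulas ordered by
-- provable implication: connectives are read intuitionistically, and □ p holds at x
-- when x implies □ u for some u in the interpretation of p.  Every HK□ theorem is
-- valid in this model, while an MI□ formula φ denotes exactly the principal
-- down-set of φ.  Hence if HK□ ⊢ φ then ⊤ lies below φ, i.e. MI□ ⊢ ⊤ → φ.
module Submission where

open import Defs
open import Function.Bundles using (_⇔_; mk⇔; module Equivalence)
open import Data.Unit using (⊤; tt)
open import Data.Empty using (⊥)
open import Data.Product using (Σ; _×_; _,_; proj₁; proj₂)
open import Data.Sum using (_⊎_; inj₁; inj₂)

open Equivalence using (to; from)

⇒₀-refl : ∀ p → MI⊢ (p ⇒₀ p)
⇒₀-refl p = mp (mp (ax-S p (p ⇒₀ p) p) (ax-K p (p ⇒₀ p))) (ax-K p p)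

⇒₀-trans : ∀ {p q r} → MI⊢ (p ⇒₀ q) → MI⊢ (q ⇒₀ r) → MI⊢ (p ⇒₀ r)
⇒₀-trans {p} {q} {r} f g = mp (mp (ax-S p q r) (mp (ax-K (q ⇒₀ r) p) g)) f

⇒₀-const : ∀ {q} p → MI⊢ q → MI⊢ (p ⇒₀ q)
⇒₀-const {q} p d = mp (ax-K q p) d

⇒₀-app : ∀ {x p q} → MI⊢ (x ⇒₀ (p ⇒₀ q)) → MI⊢ (x ⇒₀ p) → MI⊢ (x ⇒₀ q)
⇒₀-app {x} {p} {q} f g = mp (mp (ax-S x p q) f) g

∧₀-intro : ∀ {p q} → MI⊢ p → MI⊢ q → MI⊢ (p ∧₀ q)
∧₀-intro {p} {q} d e = mp (mp (ax-∧i p q) d) e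

∧₀-elimˡ : ∀ {p q} → MI⊢ (p ∧₀ q) → MI⊢ p
∧₀-elimˡ {p} {q} d = mp (ax-∧e₁ p q) d

∧₀-elimʳ : ∀ {p q} → MI⊢ (p ∧₀ q) → MI⊢ q
∧₀-elimʳ {p} {q} d = mp (ax-∧e₂ p q) d

⇒₀-pair : ∀ {x p q} → MI⊢ (x ⇒₀ p) → MI⊢ (x ⇒₀ q) → MI⊢ (x ⇒₀ (p ∧₀ q))
⇒₀-pair {x} {p} {q} f g = ⇒₀-app (⇒₀-trans f (ax-∧i p q)) g

⇒₀-fst : ∀ {x p q} → MI⊢ (x ⇒₀ (p ∧₀ q)) → MI⊢ (x ⇒₀ p)
⇒₀-fst {p = p} {q} f = ⇒₀-trans f (ax-∧e₁ p q)

⇒₀-snd : ∀ {x p q} → MI⊢ (x ⇒₀ (p ∧₀ q)) → MI⊢ (x ⇒₀ q)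
⇒₀-snd {p = p} {q} f = ⇒₀-trans f (ax-∧e₂ p q)

⇒₀-curry : ∀ {x p q} → MI⊢ ((x ∧₀ p) ⇒₀ q) → MI⊢ (x ⇒₀ (p ⇒₀ q))
⇒₀-curry {x} {p} {q} d =
  ⇒₀-app (⇒₀-app (⇒₀-const x precompose) (⇒₀-const x d)) (ax-∧i x p)
  where
  precompose : MI⊢ (((x ∧₀ p) ⇒₀ q) ⇒₀ ((p ⇒₀ (x ∧₀ p)) ⇒₀ (p ⇒₀ q)))
  precompose = ⇒₀-trans (ax-K ((x ∧₀ p) ⇒₀ q) p) (ax-S p (x ∧₀ p) q)

-- p is provably equivalent to p ∧ q, so □ p ↔ □ (p ∧ q) ↔ □ p ∧ □ q.
□₀-mono : ∀ {p q} → MI⊢ (p ⇒₀ q) → MI⊢ (□₀ p ⇒₀ □₀ q)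
□₀-mono {p} {q} d =
  ⇒₀-trans (∧₀-elimˡ (cong□ p⟺p∧q))
           (⇒₀-snd (∧₀-elimˡ (ax-□∧ p q)))
  where
  p⟺p∧q : MI⊢ (p ⟺₀ (p ∧₀ q))
  p⟺p∧q = ∧₀-intro (⇒₀-pair (⇒₀-refl p) d) (ax-∧e₁ p q)

_≼_ : Fm₀ → Fm₀ → Set
x ≼ y = MI⊢ (x ⇒₀ y)

⟦_⟧ : Fm → Fm₀ → Set
⟦ var n ⟧ x = x ≼ var₀ n
⟦ ⊤′ ⟧    x = ⊤
⟦ ⊥′ ⟧    x = ⊥
⟦ p ∧ q ⟧ x = ⟦ p ⟧ x × ⟦ q ⟧ x
⟦ p ∨ q ⟧ x = ⟦ p ⟧ x ⊎ ⟦ q ⟧ x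
⟦ p ⇒ q ⟧ x = ∀ y → y ≼ x → ⟦ p ⟧ y → ⟦ q ⟧ y
⟦ □ p ⟧   x = Σ Fm₀ λ u → ⟦ p ⟧ u × x ≼ □₀ u

⟦⟧-downward : ∀ p {x y} → y ≼ x → ⟦ p ⟧ x → ⟦ p ⟧ y
⟦⟧-downward (var n) y≼x a            = ⇒₀-trans y≼x a
⟦⟧-downward ⊤′      y≼x a            = tt
⟦⟧-downward (p ∧ q) y≼x (a , b)      = ⟦⟧-downward p y≼x a , ⟦⟧-downward q y≼x b
⟦⟧-downward (p ∨ q) y≼x (inj₁ a)     = inj₁ (⟦⟧-downward p y≼x a)
⟦⟧-downward (p ∨ q) y≼x (inj₂ b)     = inj₂ (⟦⟧-downward q y≼x b)
⟦⟧-downward (p ⇒ q) y≼x f z z≼y a    = f z (⇒₀-trans z≼y y≼x) a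
⟦⟧-downward (□ p)   y≼x (u , a , x≼□u) = u , a , ⇒₀-trans y≼x x≼□u

⟦□⟧-∧ : ∀ p q x → ⟦ □ (p ∧ q) ⟺ (□ p ∧ □ q) ⟧ x
⟦□⟧-∧ p q x = split , merge
  where
  split : ⟦ □ (p ∧ q) ⇒ (□ p ∧ □ q) ⟧ x
  split _ _ (u , (a , b) , y≼□u) = (u , a , y≼□u) , (u , b , y≼□u)

  merge : ⟦ (□ p ∧ □ q) ⇒ □ (p ∧ q) ⟧ x
  merge _ _ ((u , a , y≼□u) , (v , b , y≼□v)) =
    u ∧₀ v ,
    (⟦⟧-downward p (ax-∧e₁ u v) a , ⟦⟧-downward q (ax-∧e₂ u v) b) ,
    ⇒₀-trans (⇒₀-pair y≼□u y≼□v) (∧₀-elimʳ (ax-□∧ u v))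

⟦□⟧-⊤ : ∀ x → ⟦ □ ⊤′ ⟺ ⊤′ ⟧ x
⟦□⟧-⊤ x = (λ _ _ _ → tt)
        , (λ y _ _ → ⊤₀ , tt , ⇒₀-trans (⇒₀-const y ax-⊤) (∧₀-elimʳ ax-□⊤))

⟦⟧-sound : ∀ {φ} → HK⊢ φ → ∀ x → ⟦ φ ⟧ x
⟦⟧-sound (ax-K p q) x y _ a z z≼y _ = ⟦⟧-downward p z≼y a
⟦⟧-sound (ax-S p q r) x y _ f z z≼y g w w≼z a =
  f w (⇒₀-trans w≼z z≼y) a w (⇒₀-refl w) (g w w≼z a)
⟦⟧-sound (ax-∧e₁ p q) x y _ (a , _) = a
⟦⟧-sound (ax-∧e₂ p q) x y _ (_ , b) = b
⟦⟧-sound (ax-∧i p q) x y _ a z z≼y b = ⟦⟧-downward p z≼y a , b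
⟦⟧-sound (ax-∨i₁ p q) x y _ a = inj₁ a
⟦⟧-sound (ax-∨i₂ p q) x y _ b = inj₂ b
⟦⟧-sound (ax-∨e p q r) x y _ f z z≼y g w w≼z (inj₁ a) = f w (⇒₀-trans w≼z z≼y) a
⟦⟧-sound (ax-∨e p q r) x y _ f z z≼y g w w≼z (inj₂ b) = g w w≼z b
⟦⟧-sound (ax-⊥ p) x y _ ()
⟦⟧-sound ax-⊤ x = tt
⟦⟧-sound (ax-□∧ p q) = ⟦□⟧-∧ p q
⟦⟧-sound ax-□⊤ = ⟦□⟧-⊤
⟦⟧-sound (mp d e) x = ⟦⟧-sound d x x (⇒₀-refl x) (⟦⟧-sound e x)
⟦⟧-sound (cong□ d) x =
  (λ { _ _ (u , a , y≼□u) → u , proj₁ (⟦⟧-sound d u) u (⇒₀-refl u) a , y≼□u }) ,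
  (λ { _ _ (u , a , y≼□u) → u , proj₂ (⟦⟧-sound d u) u (⇒₀-refl u) a , y≼□u })

⟦embed⟧⇔≼ : ∀ φ x → ⟦ embed φ ⟧ x ⇔ x ≼ φ
⟦embed⟧⇔≼ (var₀ n) x = mk⇔ (λ a → a) (λ a → a)
⟦embed⟧⇔≼ ⊤₀ x = mk⇔ (λ _ → ⇒₀-const x ax-⊤) (λ _ → tt)
⟦embed⟧⇔≼ (φ ∧₀ ψ) x = mk⇔
  (λ (a , b) → ⇒₀-pair (to (⟦embed⟧⇔≼ φ x) a) (to (⟦embed⟧⇔≼ ψ x) b))
  (λ d → from (⟦embed⟧⇔≼ φ x) (⇒₀-fst d) , from (⟦embed⟧⇔≼ ψ x) (⇒₀-snd d))
⟦embed⟧⇔≼ (φ ⇒₀ ψ) x = mk⇔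
  (λ f → ⇒₀-curry (to (⟦embed⟧⇔≼ ψ (x ∧₀ φ))
           (f (x ∧₀ φ) (ax-∧e₁ x φ) (from (⟦embed⟧⇔≼ φ (x ∧₀ φ)) (ax-∧e₂ x φ)))))
  (λ d y y≼x a → from (⟦embed⟧⇔≼ ψ y) (⇒₀-app (⇒₀-trans y≼x d) (to (⟦embed⟧⇔≼ φ y) a)))
⟦embed⟧⇔≼ (□₀ φ) x = mk⇔
  (λ (u , a , x≼□u) → ⇒₀-trans x≼□u (□₀-mono (to (⟦embed⟧⇔≼ φ u) a)))
  (λ x≼□φ → φ , from (⟦embed⟧⇔≼ φ φ) (⇒₀-refl φ) , x≼□φ)

embed-MI⊢ : ∀ {φ} → MI⊢ φ → HK⊢ embed φ
embed-MI⊢ (ax-K p q)   = ax-K _ _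
embed-MI⊢ (ax-S p q r) = ax-S _ _ _
embed-MI⊢ (ax-∧e₁ p q) = ax-∧e₁ _ _
embed-MI⊢ (ax-∧e₂ p q) = ax-∧e₂ _ _
embed-MI⊢ (ax-∧i p q)  = ax-∧i _ _
embed-MI⊢ ax-⊤         = ax-⊤
embed-MI⊢ (ax-□∧ p q)  = ax-□∧ _ _
embed-MI⊢ ax-□⊤        = ax-□⊤
embed-MI⊢ (mp d e)     = mp (embed-MI⊢ d) (embed-MI⊢ e)
embed-MI⊢ (cong□ d)    = cong□ (embed-MI⊢ d)

theorem6p2 : (φ : Fm₀) → (HK⊢ embed φ) ⇔ (MI⊢ φ)
theorem6p2 φ = mk⇔ conservative embed-MI⊢
  where
  conservative : HK⊢ embed φ → MI⊢ φ
  conservative d = mp (to (⟦embed⟧⇔≼ φ ⊤₀) (⟦⟧-sound d ⊤₀)) ax-⊤
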